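{- Let $T$ be a bipartite tournament and $M\subseteq V(T)$ such that $T$ is $M$-consistent. Let $(Z_1,Z_2,\dots,Z_i,Z_{i+1},\dots)$ be the canonical sequence of $T[M]$, and let $v\in V(T)$ be an $(M,Z_i)$-conflicting vertex. Then the canonical sequence of $T[M\cup\{v\}]$ is $(Z_1,Z_2,\dots,Z_{i-1},Z_i^{(1)},\{v\},Z_i^{(2)},Z_{i+1},\dots)$, where $Z_i^{(1)}\cup Z_i^{(2)}=Z_i$ and $Z_i^{(1)}\neq\emptyset$, $Z_i^{(2)}\neq\emptyset$.
   Context: A bipartite tournament is a directed graph whose vertex set is partitioned into two sets $A,B$ such that every pair $a\in A$, $b\in B$ is joined by exactly one arc and there are no arcs inside $A$ or inside $B$. $N^+(v)$ and $N^-(v)$ denote the out- and in-neighbourhoods of $v$. For an acyclic bipartite tournament $D$, its canonical sequence $(V_1,V_2,\dots)$ is defined by: for each $i\ge 1$, $V_i$ is the set of vertices with no incoming arcs in $D-\bigcup_{j<i}V_j$ (continuing until all vertices are used). $T$ is $M$-consistent if $T[M\cup\{v\}]$ is acyclic for every $v\in V(T)$. If $T[M]$ is acyclic with canonical sequence $(Z_1,Z_2,\dots)$, a vertex $v\in V(T)$ is $(M,Z_i)$-conflicting if $N^+(v)\cap Z_i\neq\emptyset$ and $N^-(v)\cap Z_i\neq\emptyset$, and for every $j<i$, $N^+(v)\cap Z_j=\emptyset$, and for every $j>i$, $N^-(v)\cap Z_j=\emptyset$. -}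

module Defs where

open import Data.Nat using (ℕ)
open import Data.Bool using (Bool; true; false)
open import Data.Fin using (Fin; toℕ) renaming (_<_ to _<ᶠ_)
open import Data.Fin.Subset using (Subset; _∈_; _∉_; _∪_; _─_; ⁅_⁆; Nonempty; Empty)
open import Data.List using (List; []; _∷_; length; lookup)
open import Data.Product using (Σ; ∃; _×_; _,_)
open import Data.Sum using (_⊎_)
open import Relation.Binary.PropositionalEquality using (_≡_; _≢_)
open import Relation.Binary.Construct.Closure.Transitive using (TransClosure)
open import Relation.Nullary using (¬_)

-- A bipartite tournament on the vertex set Fin n.
-- side v says whether v lies in A (true) or B (false);
-- arc u v = true iff there is an arc u → v.
record BipTournament (n : ℕ) : Set where
  field
    side : Fin n → Bool
    arc  : Fin n → Fin n → Bool
    arc-between : ∀ u v → arc u v ≡ true → side u ≢ side v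
    exactly-one : ∀ u v → side u ≢ side v →
      (arc u v ≡ true × arc v u ≡ false) ⊎ (arc u v ≡ false × arc v u ≡ true)

module _ {n : ℕ} (T : BipTournament n) where
  open BipTournament T

  Arc : Fin n → Fin n → Set
  Arc u v = arc u v ≡ true

  ArcIn : Subset n → Fin n → Fin n → Set
  ArcIn S u v = u ∈ S × v ∈ S × Arc u v

  Acyclic : Subset n → Set
  Acyclic S = ∀ v → ¬ TransClosure (ArcIn S) v v

  Consistent : Subset n → Set
  Consistent M = ∀ v → Acyclic (M ∪ ⁅ v ⁆)

  IsSources : Subset n → Subset n → Set
  IsSources R Z = ∀ v → (v ∈ Z → v ∈ R × (∀ u → u ∈ R → ¬ Arc u v))
                      × (v ∈ R → (∀ u → u ∈ R → ¬ Arc u v) → v ∈ Z)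

  -- CanSeq R Zs : Zs is the canonical sequence of T[R]:
  -- V₁ = sources of T[R], and the rest is the canonical sequence of
  -- T[R ─ V₁]; the sequence stops exactly when all vertices are used.
  data CanSeq : Subset n → List (Subset n) → Set where
    done : ∀ {R} → Empty R → CanSeq R []
    step : ∀ {R Z Zs} → Nonempty R → IsSources R Z → CanSeq (R ─ Z) Zs →
           CanSeq R (Z ∷ Zs)

  -- v is (M, Z_i)-conflicting, where Zs is the canonical sequence of T[M]
  -- and i indexes Zs (0-based).
  Conflicting : (Zs : List (Subset n)) → Fin (length Zs) → Fin n → Set
  Conflicting Zs i v =
      (∃ λ w → w ∈ lookup Zs i × Arc v w)
    × (∃ λ w → w ∈ lookup Zs i × Arc w v)
    × (∀ j → j <ᶠ i → ∀ w → w ∈ lookup Zs j → ¬ Arc v w)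
    × (∀ j → i <ᶠ j → ∀ w → w ∈ lookup Zs j → ¬ Arc w v)

-- Let Z be the layer Z_i in which v conflicts. Earlier layers receive no arc from v, so they
-- remain the successive source layers once v is added, and v, dominated from Z, is not among
-- them. Within Z the new sources are Z₁ = Z ∖ N⁺(v). After removing Z₁, v is the only source:
-- later layers send no arc to v, and every other remaining vertex is dominated by v or, if it
-- lies on v's side, by Z₂ = Z ∩ N⁺(v) ≠ ∅. After removing v the sources are exactly Z₂, and
-- what remains is what remained after Z in T[M], so the later layers are unchanged. The
-- bipartite structure enters through one fact: a layer of sources lies on a single side, hence
-- dominates every remaining vertex of the other side.
module Submission where

open import Defs
open import Data.Nat using (ℕ; suc; z≤n; s≤s)
open import Data.Bool using (Bool; true)
open import Data.Bool.Properties using () renaming (_≟_ to _≟ᵇ_)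
open import Data.Fin using (Fin; toℕ; zero; suc)
open import Data.Fin.Properties using (any?)
open import Data.Fin.Subset using (Subset; inside; outside; _∈_; _∉_; _⊆_; _∪_; _∩_; _─_; _-_; ⁅_⁆; Nonempty)
open import Data.Fin.Subset.Properties using (_∈?_; ⊆-antisym; x∈p∪q⁺; x∈p∪q⁻; x∈p∩q⁺; x∈p∩q⁻; p─q⊆p; x∈p∧x∉q⇒x∈p─q; p─q─r≡p─q∪r; x∈⁅x⁆; x∈⁅y⁆⇒x≡y)
open import Data.List using (List; _∷_; _++_; length; lookup; take; drop)
open import Data.Product using (∃; _×_; _,_; proj₁; proj₂)
open import Data.Sum using (_⊎_; inj₁; inj₂; map₂)
open import Data.Vec using ([]; _∷_; tabulate; here; there)
open import Data.Vec.Properties using (lookup∘tabulate; []=⇒lookup; lookup⇒[]=)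
open import Function using (_∘_; _$_)
open import Relation.Nullary using (¬_; Dec; yes; no; contradiction)
open import Relation.Nullary.Decidable using (_×-dec_)
open import Relation.Binary.PropositionalEquality using (_≡_; _≢_; refl; sym; trans; cong; subst; module ≡-Reasoning)

private variable
  n : ℕ

x∈p─q⇒x∉q : ∀ {x : Fin n} (p q : Subset n) → x ∈ p ─ q → x ∉ q
x∈p─q⇒x∉q (inside ∷ p) (outside ∷ q) here ()
x∈p─q⇒x∉q (_ ∷ p) (_ ∷ q) (there x∈p─q) (there x∈q) = x∈p─q⇒x∉q p q x∈p─q x∈q

x∈p∪⁅x⁆ : ∀ (p : Subset n) x → x ∈ p ∪ ⁅ x ⁆
x∈p∪⁅x⁆ p x = x∈p∪q⁺ (inj₂ (x∈⁅x⁆ x))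

x∈p∪⁅y⁆⁻ : ∀ {x} (p : Subset n) y → x ∈ p ∪ ⁅ y ⁆ → x ∈ p ⊎ x ≡ y
x∈p∪⁅y⁆⁻ p y = map₂ (x∈⁅y⁆⇒x≡y y) ∘ x∈p∪q⁻ p ⁅ y ⁆

p∪⁅x⁆─q≡p─q∪⁅x⁆ : ∀ (p q : Subset n) {x} → x ∉ q → (p ∪ ⁅ x ⁆) ─ q ≡ (p ─ q) ∪ ⁅ x ⁆
p∪⁅x⁆─q≡p─q∪⁅x⁆ p q {x} x∉q = ⊆-antisym forth back
  where
  forth : (p ∪ ⁅ x ⁆) ─ q ⊆ (p ─ q) ∪ ⁅ x ⁆
  forth {y} y∈ with x∈p∪⁅y⁆⁻ p x (p─q⊆p _ q y∈)
  ... | inj₁ y∈p = x∈p∪q⁺ (inj₁ (x∈p∧x∉q⇒x∈p─q y∈p (x∈p─q⇒x∉q _ q y∈)))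
  ... | inj₂ refl = x∈p∪⁅x⁆ (p ─ q) x
  back : (p ─ q) ∪ ⁅ x ⁆ ⊆ (p ∪ ⁅ x ⁆) ─ q
  back {y} y∈ with x∈p∪⁅y⁆⁻ (p ─ q) x y∈
  ... | inj₁ y∈p─q = x∈p∧x∉q⇒x∈p─q (x∈p∪q⁺ (inj₁ (p─q⊆p p q y∈p─q))) (x∈p─q⇒x∉q p q y∈p─q)
  ... | inj₂ refl = x∈p∧x∉q⇒x∈p─q (x∈p∪⁅x⁆ p x) x∉q

p∪⁅x⁆-x≡p : ∀ (p : Subset n) {x} → x ∉ p → (p ∪ ⁅ x ⁆) - x ≡ p
p∪⁅x⁆-x≡p p {x} x∉p = ⊆-antisym forth back
  where
  forth : (p ∪ ⁅ x ⁆) - x ⊆ p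
  forth {y} y∈ with x∈p∪⁅y⁆⁻ p x (p─q⊆p _ ⁅ x ⁆ y∈)
  ... | inj₁ y∈p = y∈p
  ... | inj₂ refl = contradiction (x∈⁅x⁆ x) (x∈p─q⇒x∉q _ ⁅ x ⁆ y∈)
  back : p ⊆ (p ∪ ⁅ x ⁆) - x
  back y∈p = x∈p∧x∉q⇒x∈p─q (x∈p∪q⁺ (inj₁ y∈p)) (λ y∈⁅x⁆ → x∉p (subst (_∈ p) (x∈⁅y⁆⇒x≡y x y∈⁅x⁆) y∈p))

p─q∪p∩q≡p : ∀ (p q : Subset n) → (p ─ q) ∪ (p ∩ q) ≡ p
p─q∪p∩q≡p [] [] = refl
p─q∪p∩q≡p (inside ∷ p) (inside ∷ q) = cong (inside ∷_) (p─q∪p∩q≡p p q)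
p─q∪p∩q≡p (inside ∷ p) (outside ∷ q) = cong (inside ∷_) (p─q∪p∩q≡p p q)
p─q∪p∩q≡p (outside ∷ p) (inside ∷ q) = cong (outside ∷_) (p─q∪p∩q≡p p q)
p─q∪p∩q≡p (outside ∷ p) (outside ∷ q) = cong (outside ∷_) (p─q∪p∩q≡p p q)

x∈tabulate⁺ : ∀ (f : Fin n → Bool) {x} → f x ≡ true → x ∈ tabulate f
x∈tabulate⁺ f {x} fx≡true = lookup⇒[]= x (tabulate f) (trans (lookup∘tabulate f x) fx≡true)

x∈tabulate⁻ : ∀ (f : Fin n → Bool) {x} → x ∈ tabulate f → f x ≡ true
x∈tabulate⁻ f {x} x∈ = trans (sym (lookup∘tabulate f x)) ([]=⇒lookup x∈)

module _ (T : BipTournament n) where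
  open BipTournament T

  arc? : ∀ u v → Dec (Arc T u v)
  arc? u v = arc u v ≟ᵇ true

  arc-irrefl : ∀ {v} → ¬ Arc T v v
  arc-irrefl {v} v→v = arc-between v v v→v refl

  arc-asym : ∀ {u v} → Arc T u v → ¬ Arc T v u
  arc-asym {u} {v} u→v v→u with exactly-one u v (arc-between u v u→v)
  ... | inj₁ (_ , v↛u) = contradiction (trans (sym v→u) v↛u) λ ()
  ... | inj₂ (u↛v , _) = contradiction (trans (sym u→v) u↛v) λ ()

  arc-or-arc : ∀ {u v} → side u ≢ side v → Arc T u v ⊎ Arc T v u
  arc-or-arc {u} {v} u≁v with exactly-one u v u≁v
  ... | inj₁ (u→v , _) = inj₁ u→v
  ... | inj₂ (_ , v→u) = inj₂ v→u

  no-arc⇒same-side : ∀ {u v} → ¬ Arc T u v → ¬ Arc T v u → side u ≡ side v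
  no-arc⇒same-side {u} {v} u↛v v↛u with side u ≟ᵇ side v
  ... | yes u∼v = u∼v
  ... | no u≁v with arc-or-arc u≁v
  ...   | inj₁ u→v = contradiction u→v u↛v
  ...   | inj₂ v→u = contradiction v→u v↛u

  N⁺ : Fin n → Subset n
  N⁺ v = tabulate (arc v)

  HasInNeighbour : Subset n → Fin n → Set
  HasInNeighbour R w = ∃ λ u → u ∈ R × Arc T u w

  hasInNeighbour? : ∀ R w → Dec (HasInNeighbour R w)
  hasInNeighbour? R w = any? λ u → (u ∈? R) ×-dec arc? u w

  hasInNeighbour-mono : ∀ {R S w} → R ⊆ S → HasInNeighbour R w → HasInNeighbour S w
  hasInNeighbour-mono R⊆S (u , u∈R , u→w) = u , R⊆S u∈R , u→w

  module _ {R Z : Subset n} (src : IsSources T R Z) where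

    sources⊆ : Z ⊆ R
    sources⊆ {w} w∈Z = proj₁ (proj₁ (src w) w∈Z)

    source-no-in : ∀ {u w} → w ∈ Z → u ∈ R → ¬ Arc T u w
    source-no-in {u} {w} w∈Z = proj₂ (proj₁ (src w) w∈Z) u

    non-source-hasInNeighbour : ∀ {w} → w ∈ R → w ∉ Z → HasInNeighbour R w
    non-source-hasInNeighbour {w} w∈R w∉Z with hasInNeighbour? R w
    ... | yes dominated = dominated
    ... | no undominated = contradiction (proj₂ (src w) w∈R λ u u∈R u→w → undominated (u , u∈R , u→w)) w∉Z

    hasInNeighbour⇒∉sources : ∀ {w} → HasInNeighbour R w → w ∉ Z
    hasInNeighbour⇒∉sources (u , u∈R , u→w) w∈Z = source-no-in w∈Z u∈R u→w

    sources-same-side : ∀ {x y} → x ∈ Z → y ∈ Z → side x ≡ side y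
    sources-same-side x∈Z y∈Z =
      no-arc⇒same-side (source-no-in y∈Z (sources⊆ x∈Z)) (source-no-in x∈Z (sources⊆ y∈Z))

    source-dominates-other-side : ∀ {s w} → s ∈ Z → w ∈ R → side w ≢ side s → Arc T s w
    source-dominates-other-side s∈Z w∈R w≁s with arc-or-arc w≁s
    ... | inj₁ w→s = contradiction w→s (source-no-in s∈Z w∈R)
    ... | inj₂ s→w = s→w

  isSources : ∀ {R Z} → Z ⊆ R → (∀ {u w} → w ∈ Z → u ∈ R → ¬ Arc T u w) →
              (∀ {w} → w ∈ R → w ∉ Z → HasInNeighbour R w) → IsSources T R Z
  isSources {R} {Z} Z⊆R no-in dominated w = (λ w∈Z → Z⊆R w∈Z , λ u → no-in w∈Z) , is-source
    where
    is-source : w ∈ R → (∀ u → u ∈ R → ¬ Arc T u w) → w ∈ Z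
    is-source w∈R undominated with w ∈? Z
    ... | yes w∈Z = w∈Z
    ... | no w∉Z = let u , u∈R , u→w = dominated w∈R w∉Z in contradiction u→w (undominated u u∈R)

  step≡ : ∀ {R S Z Zs} → Nonempty R → IsSources T R Z → R ─ Z ≡ S → CanSeq T S Zs → CanSeq T R (Z ∷ Zs)
  step≡ ne src refl = step ne src

  canSeq-⊆ : ∀ {R Zs} → CanSeq T R Zs → (j : Fin (length Zs)) → lookup Zs j ⊆ R
  canSeq-⊆ (step _ src _) zero = sources⊆ src
  canSeq-⊆ (step {R} {Z} _ _ cs) (suc j) = p─q⊆p R Z ∘ canSeq-⊆ cs j

  canSeq-cover : ∀ {R Zs w} → CanSeq T R Zs → w ∈ R → ∃ λ (j : Fin (length Zs)) → w ∈ lookup Zs j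
  canSeq-cover {w = w} (done empty) w∈R = contradiction (w , w∈R) empty
  canSeq-cover {w = w} (step {R} {Z} _ _ cs) w∈R with w ∈? Z
  ... | yes w∈Z = zero , w∈Z
  ... | no w∉Z = let j , w∈Zⱼ = canSeq-cover cs (x∈p∧x∉q⇒x∈p─q w∈R w∉Z) in suc j , w∈Zⱼ

  conflicting-tail : ∀ {Z Zs i v} → Conflicting T (Z ∷ Zs) (suc i) v → Conflicting T Zs i v
  conflicting-tail (out , in′ , no-out-before , no-in-after) =
    out , in′ , (λ j j<i → no-out-before (suc j) (s≤s j<i)) , (λ j i<j → no-in-after (suc j) (s≤s i<j))

  sources-∪⁅⁆ : ∀ {R Z v} → IsSources T R Z → HasInNeighbour R v → (∀ {w} → w ∈ Z → ¬ Arc T v w) →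
                IsSources T (R ∪ ⁅ v ⁆) Z
  sources-∪⁅⁆ {R} {Z} {v} src v-dominated v↛Z = isSources (λ w∈Z → x∈p∪q⁺ (inj₁ (sources⊆ src w∈Z))) no-in dominated
    where
    no-in : ∀ {u w} → w ∈ Z → u ∈ R ∪ ⁅ v ⁆ → ¬ Arc T u w
    no-in w∈Z u∈ with x∈p∪⁅y⁆⁻ R v u∈
    ... | inj₁ u∈R = source-no-in src w∈Z u∈R
    ... | inj₂ refl = v↛Z w∈Z
    dominated : ∀ {w} → w ∈ R ∪ ⁅ v ⁆ → w ∉ Z → HasInNeighbour (R ∪ ⁅ v ⁆) w
    dominated w∈ w∉Z with x∈p∪⁅y⁆⁻ R v w∈
    ... | inj₁ w∈R = hasInNeighbour-mono (x∈p∪q⁺ ∘ inj₁) (non-source-hasInNeighbour src w∈R w∉Z)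
    ... | inj₂ refl = hasInNeighbour-mono (x∈p∪q⁺ ∘ inj₁) v-dominated

  module FirstLayerSplit {R Z : Subset n} {v w₁ w₂ : Fin n} (src : IsSources T R Z)
    (w₁∈Z : w₁ ∈ Z) (w₁→v : Arc T w₁ v) (w₂∈Z : w₂ ∈ Z) (v→w₂ : Arc T v w₂)
    (no-later-in : ∀ {u} → u ∈ R → u ∉ Z → ¬ Arc T u v) where

    Z₁ Z₂ : Subset n
    Z₁ = Z ─ N⁺ v
    Z₂ = Z ∩ N⁺ v

    ∈Z₁⁺ : ∀ {w} → w ∈ Z → ¬ Arc T v w → w ∈ Z₁
    ∈Z₁⁺ w∈Z v↛w = x∈p∧x∉q⇒x∈p─q w∈Z (v↛w ∘ x∈tabulate⁻ (arc v))

    ∈Z₁⁻ : ∀ {w} → w ∈ Z₁ → w ∈ Z × ¬ Arc T v w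
    ∈Z₁⁻ w∈Z₁ = p─q⊆p Z (N⁺ v) w∈Z₁ , x∈p─q⇒x∉q Z (N⁺ v) w∈Z₁ ∘ x∈tabulate⁺ (arc v)

    ∈Z₂⁺ : ∀ {w} → w ∈ Z → Arc T v w → w ∈ Z₂
    ∈Z₂⁺ w∈Z v→w = x∈p∩q⁺ (w∈Z , x∈tabulate⁺ (arc v) v→w)

    ∈Z₂⁻ : ∀ {w} → w ∈ Z₂ → w ∈ Z × Arc T v w
    ∈Z₂⁻ w∈Z₂ = let w∈Z , w∈N⁺ = x∈p∩q⁻ Z (N⁺ v) w∈Z₂ in w∈Z , x∈tabulate⁻ (arc v) w∈N⁺

    Z₁∪Z₂≡Z : Z₁ ∪ Z₂ ≡ Z
    Z₁∪Z₂≡Z = p─q∪p∩q≡p Z (N⁺ v)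

    Z∖Z₁⊆N⁺ : ∀ {w} → w ∈ Z → w ∉ Z₁ → Arc T v w
    Z∖Z₁⊆N⁺ {w} w∈Z w∉Z₁ with arc? v w
    ... | yes v→w = v→w
    ... | no v↛w = contradiction (∈Z₁⁺ w∈Z v↛w) w∉Z₁

    v∉R : v ∉ R
    v∉R v∈R = source-no-in src w₂∈Z v∈R v→w₂

    v∉R─Z₁ : v ∉ R ─ Z₁
    v∉R─Z₁ = v∉R ∘ p─q⊆p R Z₁

    Z₂⊆R─Z₁ : Z₂ ⊆ R ─ Z₁
    Z₂⊆R─Z₁ w∈Z₂ = let w∈Z , v→w = ∈Z₂⁻ w∈Z₂ in
      x∈p∧x∉q⇒x∈p─q (sources⊆ src w∈Z) (λ w∈Z₁ → proj₂ (∈Z₁⁻ w∈Z₁) v→w)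

    w₂∈R─Z₁ : w₂ ∈ R ─ Z₁
    w₂∈R─Z₁ = Z₂⊆R─Z₁ (∈Z₂⁺ w₂∈Z v→w₂)

    sources-Z₁ : IsSources T (R ∪ ⁅ v ⁆) Z₁
    sources-Z₁ = isSources (x∈p∪q⁺ ∘ inj₁ ∘ sources⊆ src ∘ proj₁ ∘ ∈Z₁⁻) no-in dominated
      where
      no-in : ∀ {u w} → w ∈ Z₁ → u ∈ R ∪ ⁅ v ⁆ → ¬ Arc T u w
      no-in w∈Z₁ u∈ with x∈p∪⁅y⁆⁻ R v u∈
      ... | inj₁ u∈R = source-no-in src (proj₁ (∈Z₁⁻ w∈Z₁)) u∈R
      ... | inj₂ refl = proj₂ (∈Z₁⁻ w∈Z₁)
      dominated : ∀ {w} → w ∈ R ∪ ⁅ v ⁆ → w ∉ Z₁ → HasInNeighbour (R ∪ ⁅ v ⁆) w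
      dominated {w} w∈ w∉Z₁ with x∈p∪⁅y⁆⁻ R v w∈ | w ∈? Z
      ... | inj₂ refl | _ = w₁ , x∈p∪q⁺ (inj₁ (sources⊆ src w₁∈Z)) , w₁→v
      ... | inj₁ _ | yes w∈Z = v , x∈p∪⁅x⁆ R v , Z∖Z₁⊆N⁺ w∈Z w∉Z₁
      ... | inj₁ w∈R | no w∉Z = hasInNeighbour-mono (x∈p∪q⁺ ∘ inj₁) (non-source-hasInNeighbour src w∈R w∉Z)

    -- A vertex beyond Z on v's side is on the other side from w₂, because v → w₂.
    beyond-Z-dominated : ∀ {w} → w ∈ R → w ∉ Z → Arc T v w ⊎ Arc T w₂ w
    beyond-Z-dominated {w} w∈R w∉Z with side w ≟ᵇ side v
    ... | yes w∼v = inj₂ (source-dominates-other-side src w₂∈Z w∈R λ w∼w₂ →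
                      arc-between v w₂ v→w₂ (trans (sym w∼v) w∼w₂))
    ... | no w≁v with arc-or-arc w≁v
    ...   | inj₁ w→v = contradiction w→v (no-later-in w∈R w∉Z)
    ...   | inj₂ v→w = inj₁ v→w

    sources-v : IsSources T ((R ─ Z₁) ∪ ⁅ v ⁆) ⁅ v ⁆
    sources-v = isSources (x∈p∪q⁺ ∘ inj₂) no-in dominated
      where
      no-in : ∀ {u w} → w ∈ ⁅ v ⁆ → u ∈ (R ─ Z₁) ∪ ⁅ v ⁆ → ¬ Arc T u w
      no-in {u} w∈⁅v⁆ u∈ with x∈⁅y⁆⇒x≡y v w∈⁅v⁆ | x∈p∪⁅y⁆⁻ (R ─ Z₁) v u∈ | u ∈? Z
      ... | refl | inj₂ refl | _ = arc-irrefl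
      ... | refl | inj₁ u∈R─Z₁ | yes u∈Z = arc-asym (Z∖Z₁⊆N⁺ u∈Z (x∈p─q⇒x∉q R Z₁ u∈R─Z₁))
      ... | refl | inj₁ u∈R─Z₁ | no u∉Z = no-later-in (p─q⊆p R Z₁ u∈R─Z₁) u∉Z
      dominated : ∀ {w} → w ∈ (R ─ Z₁) ∪ ⁅ v ⁆ → w ∉ ⁅ v ⁆ → HasInNeighbour ((R ─ Z₁) ∪ ⁅ v ⁆) w
      dominated {w} w∈ w∉⁅v⁆ with x∈p∪⁅y⁆⁻ (R ─ Z₁) v w∈
      ... | inj₂ refl = contradiction (x∈⁅x⁆ v) w∉⁅v⁆
      ... | inj₁ w∈R─Z₁ with w ∈? Z
      ...   | yes w∈Z = v , x∈p∪⁅x⁆ _ v , Z∖Z₁⊆N⁺ w∈Z (x∈p─q⇒x∉q R Z₁ w∈R─Z₁)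
      ...   | no w∉Z with beyond-Z-dominated (p─q⊆p R Z₁ w∈R─Z₁) w∉Z
      ...     | inj₁ v→w = v , x∈p∪⁅x⁆ _ v , v→w
      ...     | inj₂ w₂→w = w₂ , x∈p∪q⁺ (inj₁ w₂∈R─Z₁) , w₂→w

    sources-Z₂ : IsSources T (R ─ Z₁) Z₂
    sources-Z₂ = isSources Z₂⊆R─Z₁ (λ w∈Z₂ → source-no-in src (proj₁ (∈Z₂⁻ w∈Z₂)) ∘ p─q⊆p R Z₁) dominated
      where
      dominated : ∀ {w} → w ∈ R ─ Z₁ → w ∉ Z₂ → HasInNeighbour (R ─ Z₁) w
      dominated {w} w∈R─Z₁ w∉Z₂ with w ∈? Z | side w ≟ᵇ side w₂
      ... | yes w∈Z | _ = contradiction (∈Z₂⁺ w∈Z (Z∖Z₁⊆N⁺ w∈Z (x∈p─q⇒x∉q R Z₁ w∈R─Z₁))) w∉Z₂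
      ... | no _ | no w≁w₂ = w₂ , w₂∈R─Z₁ , source-dominates-other-side src w₂∈Z w∈R w≁w₂
        where w∈R = p─q⊆p R Z₁ w∈R─Z₁
      ... | no w∉Z | yes w∼w₂ =
        -- an in-neighbour in R cannot lie in Z, which is on w's side
        let u , u∈R , u→w = non-source-hasInNeighbour src (p─q⊆p R Z₁ w∈R─Z₁) w∉Z
            u∉Z u∈Z = arc-between u w u→w (trans (sources-same-side src u∈Z w₂∈Z) (sym w∼w₂))
        in u , x∈p∧x∉q⇒x∈p─q u∈R (u∉Z ∘ proj₁ ∘ ∈Z₁⁻) , u→w

    canSeq-split : ∀ {Zs} → CanSeq T (R ─ Z) Zs → CanSeq T (R ∪ ⁅ v ⁆) (Z₁ ∷ ⁅ v ⁆ ∷ Z₂ ∷ Zs)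
    canSeq-split cs =
      step≡ (v , x∈p∪⁅x⁆ R v) sources-Z₁ (p∪⁅x⁆─q≡p─q∪⁅x⁆ R Z₁ (v∉R ∘ sources⊆ src ∘ p─q⊆p Z (N⁺ v))) $
      step≡ (v , x∈p∪⁅x⁆ (R ─ Z₁) v) sources-v (p∪⁅x⁆-x≡p (R ─ Z₁) v∉R─Z₁) $
      step≡ (w₂ , w₂∈R─Z₁) sources-Z₂ R─Z₁─Z₂≡R─Z cs
      where
      open ≡-Reasoning
      R─Z₁─Z₂≡R─Z : R ─ Z₁ ─ Z₂ ≡ R ─ Z
      R─Z₁─Z₂≡R─Z = begin
        R ─ Z₁ ─ Z₂    ≡⟨ p─q─r≡p─q∪r R Z₁ Z₂ ⟩
        R ─ (Z₁ ∪ Z₂)  ≡⟨ cong (R ─_) Z₁∪Z₂≡Z ⟩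
        R ─ Z          ∎

  canSeq-insert-conflicting : ∀ {R} (Zs : List (Subset n)) → CanSeq T R Zs →
    (i : Fin (length Zs)) (v : Fin n) → Conflicting T Zs i v →
    ∃ λ (Z₁ : Subset n) → ∃ λ (Z₂ : Subset n) →
      (Z₁ ∪ Z₂ ≡ lookup Zs i) × Nonempty Z₁ × Nonempty Z₂ ×
      CanSeq T (R ∪ ⁅ v ⁆) (take (toℕ i) Zs ++ (Z₁ ∷ ⁅ v ⁆ ∷ Z₂ ∷ drop (suc (toℕ i)) Zs))
  canSeq-insert-conflicting (Z ∷ Zs) (step {R} _ src cs) zero v
    ((w₂ , w₂∈Z , v→w₂) , (w₁ , w₁∈Z , w₁→v) , _ , no-in-after) =
    Z₁ , Z₂ , Z₁∪Z₂≡Z , (w₁ , ∈Z₁⁺ w₁∈Z (arc-asym w₁→v)) , (w₂ , ∈Z₂⁺ w₂∈Z v→w₂) , canSeq-split cs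
    where
    no-later-in : ∀ {u} → u ∈ R → u ∉ Z → ¬ Arc T u v
    no-later-in u∈R u∉Z = let j , u∈Zⱼ = canSeq-cover cs (x∈p∧x∉q⇒x∈p─q u∈R u∉Z) in
      no-in-after (suc j) (s≤s z≤n) _ u∈Zⱼ
    open FirstLayerSplit src w₁∈Z w₁→v w₂∈Z v→w₂ no-later-in
  canSeq-insert-conflicting (Z ∷ Zs) (step {R} _ src cs) (suc i) v c@(_ , (w , w∈Zᵢ , w→v) , no-out-before , _) =
    let Z₁ , Z₂ , Z₁∪Z₂≡Zᵢ , ne₁ , ne₂ , cs′ = canSeq-insert-conflicting Zs cs i v (conflicting-tail c)
        v-dominated = w , p─q⊆p R Z (canSeq-⊆ cs i w∈Zᵢ) , w→v
    in Z₁ , Z₂ , Z₁∪Z₂≡Zᵢ , ne₁ , ne₂ ,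
       step≡ (v , x∈p∪⁅x⁆ R v) (sources-∪⁅⁆ src v-dominated (no-out-before zero (s≤s z≤n) _))
             (p∪⁅x⁆─q≡p─q∪⁅x⁆ R Z (hasInNeighbour⇒∉sources src v-dominated)) cs′

lemma11 : ∀ {n} (T : BipTournament n) (M : Subset n) → Consistent T M →
    (Zs : List (Subset n)) → CanSeq T M Zs →
    (i : Fin (length Zs)) (v : Fin n) → Conflicting T Zs i v →
    ∃ λ (Z₁ : Subset n) → ∃ λ (Z₂ : Subset n) →
      (Z₁ ∪ Z₂ ≡ lookup Zs i) × Nonempty Z₁ × Nonempty Z₂ ×
      CanSeq T (M ∪ ⁅ v ⁆)
        (take (toℕ i) Zs ++ (Z₁ ∷ ⁅ v ⁆ ∷ Z₂ ∷ drop (suc (toℕ i)) Zs))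
lemma11 T M _ = canSeq-insert-conflicting T
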